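{- Assume $G$ is a 3-connected graph and $\mathcal{T}$ is a tangle in $G$ of order at least 4. Then, for every two distinct inclusion-wise maximal $\mathcal{T}$-predongles $D_1$ and $D_2$, we have $D_1\cap D_2=\emptyset$ and, furthermore, at most one edge of $G$ has one endpoint in $D_1$ and the other in $D_2$.
   Context: A separation of $G$ is a pair $(A,B)$ with $A\cup B=V(G)$ and no edge between $A\setminus B$ and $B\setminus A$; its order is $|A\cap B|$. A tangle of order $k$ in $G$ is a set $\mathcal{T}$ of separations of order less than $k$ such that for every separation $(A,B)$ of order less than $k$, $(A,B)\in\mathcal{T}$ or $(B,A)\in\mathcal{T}$, and for all $(A_1,B_1),(A_2,B_2),(A_3,B_3)\in\mathcal{T}$, $A_1\cup A_2\cup A_3\ne V(G)$. A $\mathcal{T}$-predongle is a set $D\subseteq V(G)$ with $|N(D)|\le 3$ and $(N[D],V(G)\setminus D)\in\mathcal{T}$, where $N(D)$ is the open and $N[D]=D\cup N(D)$ the closed neighborhood. -}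

module Defs where

open import Data.Nat using (ℕ; zero; suc; _<_; _≤_)
open import Data.Bool using (Bool; true; false; _∧_; _∨_; not)
open import Data.Fin using (Fin)
open import Data.Fin.Subset using (Subset; _∈_; _∉_; _⊆_; _∩_; _∪_; _─_; ∁; ∣_∣; ⊤; Nonempty)
open import Data.Vec using (Vec; tabulate; lookup)
open import Data.Product using (Σ; _×_; _,_)
open import Data.Sum using (_⊎_)
open import Relation.Binary.PropositionalEquality using (_≡_; _≢_)
open import Relation.Nullary using (¬_)

record Graph (n : ℕ) : Set where
  field
    adj   : Fin n → Fin n → Bool
    sym   : ∀ u v → adj u v ≡ adj v u
    irrefl : ∀ v → adj v v ≡ false

open Graph public

module _ {n : ℕ} (G : Graph n) where

  Adj : Fin n → Fin n → Set
  Adj u v = adj G u v ≡ true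

  data Reach (S : Subset n) (u : Fin n) : Fin n → Set where
    here : u ∈ S → Reach S u u
    step : ∀ {w v} → Reach S u w → Adj w v → v ∈ S → Reach S u v

  ConnectedOn : Subset n → Set
  ConnectedOn S = Nonempty S × (∀ u v → u ∈ S → v ∈ S → Reach S u v)

  KConnected : ℕ → Set
  KConnected k = k < n × (∀ (X : Subset n) → ∣ X ∣ < k → ConnectedOn (∁ X))

  IsSeparation : Subset n → Subset n → Set
  IsSeparation A B =
    (A ∪ B ≡ ⊤) ×
    (∀ u v → u ∈ (A ─ B) → v ∈ (B ─ A) → ¬ Adj u v)

  order : Subset n → Subset n → ℕ
  order A B = ∣ A ∩ B ∣

  IsTangle : ℕ → (Subset n → Subset n → Set) → Set
  IsTangle k 𝒯 =
    (∀ A B → 𝒯 A B → IsSeparation A B × order A B < k) ×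
    (∀ A B → IsSeparation A B → order A B < k → 𝒯 A B ⊎ 𝒯 B A) ×
    (∀ A₁ B₁ A₂ B₂ A₃ B₃ → 𝒯 A₁ B₁ → 𝒯 A₂ B₂ → 𝒯 A₃ B₃ →
       A₁ ∪ (A₂ ∪ A₃) ≢ ⊤)

  anyFin : ∀ {m} → (Fin m → Bool) → Bool
  anyFin {zero} f = false
  anyFin {suc m} f = f Fin.zero ∨ anyFin (λ i → f (Fin.suc i))

  N : Subset n → Subset n
  N D = tabulate (λ v → not (lookup D v) ∧ anyFin (λ u → lookup D u ∧ adj G u v))

  N[_] : Subset n → Subset n
  N[ D ] = D ∪ N D

  IsPredongle : (Subset n → Subset n → Set) → Subset n → Set
  IsPredongle 𝒯 D = (∣ N D ∣ ≤ 3) × 𝒯 N[ D ] (∁ D)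

  IsMaximalPredongle : (Subset n → Subset n → Set) → Subset n → Set
  IsMaximalPredongle 𝒯 D =
    IsPredongle 𝒯 D × (∀ D′ → IsPredongle 𝒯 D′ → D ⊆ D′ → D′ ≡ D)

-- Let X be the set of vertices lying in N[D₁] ∩ N[D₂] but not in D₁ ∩ D₂. Counting
-- gives |X| + |N(D₁ ∪ D₂)| ≤ |N D₁| + |N D₂| ≤ 6. If |N(D₁ ∪ D₂)| ≤ 3, the tangle
-- orients (N[D₁ ∪ D₂], V ∖ (D₁ ∪ D₂)) with the union on the small side (the other
-- orientation would cover V together with N[D₁] and N[D₂]), so D₁ ∪ D₂ is a predongle
-- and maximality forces D₁ = D₂. Hence |X| ≤ 2 and G - X is connected. A path in
-- G - X starting in D₁ ∩ D₂ never leaves D₁ ∩ D₂, yet it reaches some vertex outside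
-- N[D₁], which exists because a small side of a tangle is never all of V; so D₁ and
-- D₂ are disjoint. Finally both ends of an edge between D₁ and D₂ lie in X, and two
-- different such edges would put three vertices into X.
module Submission where

open import Defs
open import Data.Bool using (Bool; true; false; _∧_; _∨_; not)
open import Data.Bool.Properties using (∧-conicalˡ; ∧-conicalʳ; ∨-zeroʳ; ¬-not)
open import Data.Empty using (⊥; ⊥-elim)
open import Data.Fin using (Fin; zero; suc; _≟_)
open import Data.Fin.Subset using (Subset; _∈_; _∉_; _⊆_; _∩_; _∪_; _─_; _-_; ∁; ∣_∣; ⊤; inside; outside)
open import Data.Fin.Subset.Properties
  using ( _∈?_; nonempty?; ⊆-antisym; ⊆⊤; p⊆p∪q; q⊆p∪q; p⊆q⇒∣p∣≤∣q∣; x∈p⇒∣p-x∣<∣p∣; x∈p∧x≢y⇒x∈p-y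
        ; x∈p∩q⁺; x∈p∩q⁻; x∈p∪q⁺; x∈p∪q⁻; x∈∁p⇒x∉p; x∉∁p⇒x∈p; x∉p⇒x∈∁p )
open import Data.Nat using (ℕ; suc; _+_; _≤_; _<_; z≤n; s≤s; _<?_)
open import Data.Nat.Properties using (≤-refl; ≤-trans; +-suc; +-mono-≤; +-cancelˡ-≤; <⇒≱; ≮⇒≥; module ≤-Reasoning)
open import Data.Product using (∃; _×_; _,_; proj₁; proj₂)
open import Data.Sum using (_⊎_; inj₁; inj₂; map)
open import Data.Vec using ([]; _∷_; lookup; tabulate; here; there)
open import Data.Vec.Properties using ([]=⇒lookup; lookup⇒[]=; lookup∘tabulate)
open import Relation.Binary.PropositionalEquality using (_≡_; _≢_; ≢-sym; refl; trans; cong; cong₂)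
  renaming (sym to ≡-sym)
open import Relation.Nullary using (Dec; yes; no)

private
  variable
    n : ℕ
    x y z : Fin n
    p q r s : Subset n

all∈⇒≡⊤ : (∀ x → x ∈ p) → p ≡ ⊤
all∈⇒≡⊤ all∈ = ⊆-antisym ⊆⊤ (λ {x} _ → all∈ x)

x∈p─q⇒x∉q : ∀ (p q : Subset n) → x ∈ p ─ q → x ∉ q
x∈p─q⇒x∉q (_ ∷ p) (_ ∷ q) (there x∈p─q) (there x∈q) = x∈p─q⇒x∉q p q x∈p─q x∈q
x∈p─q⇒x∉q (_ ∷ p) (inside ∷ q) () here

x∉p∪q⇒x∉p : ∀ p q → x ∉ p ∪ q → x ∉ p
x∉p∪q⇒x∉p _ _ x∉p∪q x∈p = x∉p∪q (x∈p∪q⁺ (inj₁ x∈p))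

x∉p∪q⇒x∉q : ∀ p q → x ∉ p ∪ q → x ∉ q
x∉p∪q⇒x∉q _ _ x∉p∪q x∈q = x∉p∪q (x∈p∪q⁺ (inj₂ x∈q))

∣p∪q∣+∣p∩q∣≡∣p∣+∣q∣ : ∀ (p q : Subset n) → ∣ p ∪ q ∣ + ∣ p ∩ q ∣ ≡ ∣ p ∣ + ∣ q ∣
∣p∪q∣+∣p∩q∣≡∣p∣+∣q∣ []            []            = refl
∣p∪q∣+∣p∩q∣≡∣p∣+∣q∣ (outside ∷ p) (outside ∷ q) = ∣p∪q∣+∣p∩q∣≡∣p∣+∣q∣ p q
∣p∪q∣+∣p∩q∣≡∣p∣+∣q∣ (inside  ∷ p) (outside ∷ q) = cong suc (∣p∪q∣+∣p∩q∣≡∣p∣+∣q∣ p q)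
∣p∪q∣+∣p∩q∣≡∣p∣+∣q∣ (outside ∷ p) (inside  ∷ q) =
  trans (cong suc (∣p∪q∣+∣p∩q∣≡∣p∣+∣q∣ p q)) (≡-sym (+-suc ∣ p ∣ ∣ q ∣))
∣p∪q∣+∣p∩q∣≡∣p∣+∣q∣ (inside  ∷ p) (inside  ∷ q) =
  cong suc (trans (+-suc ∣ p ∪ q ∣ ∣ p ∩ q ∣)
                  (trans (cong suc (∣p∪q∣+∣p∩q∣≡∣p∣+∣q∣ p q)) (≡-sym (+-suc ∣ p ∣ ∣ q ∣))))

p∪q⊆r∪s∧p∩q⊆r∩s⇒∣p∣+∣q∣≤∣r∣+∣s∣ :
  p ∪ q ⊆ r ∪ s → p ∩ q ⊆ r ∩ s → ∣ p ∣ + ∣ q ∣ ≤ ∣ r ∣ + ∣ s ∣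
p∪q⊆r∪s∧p∩q⊆r∩s⇒∣p∣+∣q∣≤∣r∣+∣s∣ {p = p} {q} {r} {s} ∪⊆ ∩⊆ = begin
  ∣ p ∣ + ∣ q ∣          ≡⟨ ∣p∪q∣+∣p∩q∣≡∣p∣+∣q∣ p q ⟨
  ∣ p ∪ q ∣ + ∣ p ∩ q ∣  ≤⟨ +-mono-≤ (p⊆q⇒∣p∣≤∣q∣ ∪⊆) (p⊆q⇒∣p∣≤∣q∣ ∩⊆) ⟩
  ∣ r ∪ s ∣ + ∣ r ∩ s ∣  ≡⟨ ∣p∪q∣+∣p∩q∣≡∣p∣+∣q∣ r s ⟩
  ∣ r ∣ + ∣ s ∣          ∎
  where open ≤-Reasoning

x,y,z∈p⇒3≤∣p∣ : x ∈ p → y ∈ p → z ∈ p → x ≢ y → x ≢ z → y ≢ z → 3 ≤ ∣ p ∣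
x,y,z∈p⇒3≤∣p∣ {x = x} {p = p} {y} {z} x∈p y∈p z∈p x≢y x≢z y≢z =
  ≤-trans (s≤s (≤-trans (s≤s 1≤∣p-x-y∣) ∣p-x-y∣<∣p-x∣)) ∣p-x∣<∣p∣
  where
  y∈p-x : y ∈ p - x
  y∈p-x = x∈p∧x≢y⇒x∈p-y y∈p (λ y≡x → x≢y (≡-sym y≡x))
  z∈p-x-y : z ∈ p - x - y
  z∈p-x-y = x∈p∧x≢y⇒x∈p-y (x∈p∧x≢y⇒x∈p-y z∈p (λ z≡x → x≢z (≡-sym z≡x))) (λ z≡y → y≢z (≡-sym z≡y))
  1≤∣p-x-y∣ : 1 ≤ ∣ p - x - y ∣
  1≤∣p-x-y∣ = ≤-trans (s≤s z≤n) (x∈p⇒∣p-x∣<∣p∣ z∈p-x-y)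
  ∣p-x-y∣<∣p-x∣ : ∣ p - x - y ∣ < ∣ p - x ∣
  ∣p-x-y∣<∣p-x∣ = x∈p⇒∣p-x∣<∣p∣ y∈p-x
  ∣p-x∣<∣p∣ : ∣ p - x ∣ < ∣ p ∣
  ∣p-x∣<∣p∣ = x∈p⇒∣p-x∣<∣p∣ x∈p

∈tabulate⁺ : ∀ {f : Fin n → Bool} → f x ≡ true → x ∈ tabulate f
∈tabulate⁺ {x = x} {f} fx = lookup⇒[]= x (tabulate f) (trans (lookup∘tabulate f x) fx)

∈tabulate⁻ : ∀ {f : Fin n → Bool} → x ∈ tabulate f → f x ≡ true
∈tabulate⁻ {x = x} {f} x∈ = trans (≡-sym (lookup∘tabulate f x)) ([]=⇒lookup x∈)

module _ (G : Graph n) where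

  Adj-sym : Adj G x y → Adj G y x
  Adj-sym {x = x} {y} xy = trans (sym G y x) xy

  anyFin-true⁺ : ∀ {m} (f : Fin m → Bool) i → f i ≡ true → anyFin G f ≡ true
  anyFin-true⁺ f zero    fi = cong (_∨ anyFin G (λ j → f (suc j))) fi
  anyFin-true⁺ f (suc i) fi =
    trans (cong (f zero ∨_) (anyFin-true⁺ (λ j → f (suc j)) i fi)) (∨-zeroʳ (f zero))

  anyFin-true⁻ : ∀ {m} (f : Fin m → Bool) → anyFin G f ≡ true → ∃ λ i → f i ≡ true
  anyFin-true⁻ {suc m} f any with f zero in f0
  ... | true  = zero , f0
  ... | false with anyFin-true⁻ (λ j → f (suc j)) any
  ...   | i , fi = suc i , fi

  ∈N⁺ : ∀ {D} → x ∈ D → Adj G x y → y ∉ D → y ∈ N G D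
  ∈N⁺ {x = x} {y} {D} x∈D xy y∉D =
    ∈tabulate⁺ (cong₂ _∧_ not-D[y] (anyFin-true⁺ _ x (trans (cong (_∧ adj G x y) ([]=⇒lookup x∈D)) xy)))
    where
    not-D[y] : not (lookup D y) ≡ true
    not-D[y] = ≡-sym (¬-not λ true≡D[y] → y∉D (lookup⇒[]= y D (≡-sym true≡D[y])))

  ∈N⁻ : ∀ {D} → y ∈ N G D → y ∉ D × ∃ λ x → x ∈ D × Adj G x y
  ∈N⁻ {y = y} {D} y∈ND with anyFin-true⁻ _ (∧-conicalʳ _ _ (∈tabulate⁻ y∈ND))
  ... | x , D[x]∧xy = y∉D , x , lookup⇒[]= x D (∧-conicalˡ _ _ D[x]∧xy) , ∧-conicalʳ _ _ D[x]∧xy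
    where
    y∉D : y ∉ D
    y∉D y∈D with () ← trans (cong not (≡-sym ([]=⇒lookup y∈D))) (∧-conicalˡ _ _ (∈tabulate⁻ y∈ND))

  ∈N[]⁺ : ∀ {D} → x ∈ D → Adj G x y → y ∈ N[_] G D
  ∈N[]⁺ {y = y} {D} x∈D xy with y ∈? D
  ... | yes y∈D = x∈p∪q⁺ (inj₁ y∈D)
  ... | no  y∉D = x∈p∪q⁺ (inj₂ (∈N⁺ x∈D xy y∉D))

  ∈N[]∧∉⇒∈N : ∀ {D} → x ∈ N[_] G D → x ∉ D → x ∈ N G D
  ∈N[]∧∉⇒∈N {D = D} x∈N[D] x∉D with x∈p∪q⁻ D (N G D) x∈N[D]
  ... | inj₁ x∈D  = ⊥-elim (x∉D x∈D)
  ... | inj₂ x∈ND = x∈ND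

  N[]-∁-separation : ∀ D → IsSeparation G (N[_] G D) (∁ D)
  N[]-∁-separation D = all∈⇒≡⊤ covered , no-edge
    where
    covered : ∀ x → x ∈ N[_] G D ∪ ∁ D
    covered x with x ∈? D
    ... | yes x∈D = x∈p∪q⁺ (inj₁ (x∈p∪q⁺ (inj₁ x∈D)))
    ... | no  x∉D = x∈p∪q⁺ (inj₂ (x∉p⇒x∈∁p x∉D))
    no-edge : ∀ u v → u ∈ N[_] G D ─ ∁ D → v ∈ ∁ D ─ N[_] G D → Adj G u v → ⊥
    no-edge u v u∈ v∈ uv =
      x∈p─q⇒x∉q (∁ D) (N[_] G D) v∈ (∈N[]⁺ (x∉∁p⇒x∈p (x∈p─q⇒x∉q (N[_] G D) (∁ D) u∈)) uv)

  order-N[]-∁≤∣N∣ : ∀ D → order G (N[_] G D) (∁ D) ≤ ∣ N G D ∣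
  order-N[]-∁≤∣N∣ D = p⊆q⇒∣p∣≤∣q∣ λ x∈ →
    let x∈N[D] , x∈∁D = x∈p∩q⁻ (N[_] G D) (∁ D) x∈ in ∈N[]∧∉⇒∈N x∈N[D] (x∈∁p⇒x∉p x∈∁D)

  Reach-closed : ∀ {S D} → (∀ {x y} → x ∈ D → Adj G x y → y ∈ S → y ∈ D) →
                 Reach G S x y → x ∈ D → y ∈ D
  Reach-closed closed (here _)          x∈D = x∈D
  Reach-closed closed (step path wy y∈S) x∈D = closed (Reach-closed closed path x∈D) wy y∈S

  N-∪⊆N∪N : ∀ D₁ D₂ → N G (D₁ ∪ D₂) ⊆ N G D₁ ∪ N G D₂
  N-∪⊆N∪N D₁ D₂ x∈N with ∈N⁻ x∈N
  ... | x∉D , u , u∈D , ux with x∈p∪q⁻ D₁ D₂ u∈D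
  ...   | inj₁ u∈D₁ = x∈p∪q⁺ (inj₁ (∈N⁺ u∈D₁ ux (x∉p∪q⇒x∉p D₁ D₂ x∉D)))
  ...   | inj₂ u∈D₂ = x∈p∪q⁺ (inj₂ (∈N⁺ u∈D₂ ux (x∉p∪q⇒x∉q D₁ D₂ x∉D)))

  crossing : Subset n → Subset n → Subset n
  crossing D₁ D₂ = (N[_] G D₁ ∩ N[_] G D₂) ∩ (∁ D₁ ∪ ∁ D₂)

  ∈crossing⁺ : ∀ {D₁ D₂} → x ∈ N[_] G D₁ → x ∈ N[_] G D₂ → x ∉ D₁ ⊎ x ∉ D₂ →
               x ∈ crossing D₁ D₂
  ∈crossing⁺ x∈N[D₁] x∈N[D₂] x∉D =
    x∈p∩q⁺ (x∈p∩q⁺ (x∈N[D₁] , x∈N[D₂]) , x∈p∪q⁺ (map x∉p⇒x∈∁p x∉p⇒x∈∁p x∉D))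

  ∈crossing⁻ : ∀ {D₁ D₂} → x ∈ crossing D₁ D₂ →
               x ∈ N[_] G D₁ × x ∈ N[_] G D₂ × (x ∉ D₁ ⊎ x ∉ D₂)
  ∈crossing⁻ {D₁ = D₁} {D₂} x∈X
    with x∈N[D₁]∩N[D₂] , x∈∁D₁∪∁D₂ ← x∈p∩q⁻ (N[_] G D₁ ∩ N[_] G D₂) (∁ D₁ ∪ ∁ D₂) x∈X
    with x∈N[D₁] , x∈N[D₂] ← x∈p∩q⁻ (N[_] G D₁) (N[_] G D₂) x∈N[D₁]∩N[D₂]
    = x∈N[D₁] , x∈N[D₂] , map x∈∁p⇒x∉p x∈∁p⇒x∉p (x∈p∪q⁻ (∁ D₁) (∁ D₂) x∈∁D₁∪∁D₂)

  ∣crossing∣+∣N-∪∣≤∣N∣+∣N∣ : ∀ D₁ D₂ →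
    ∣ crossing D₁ D₂ ∣ + ∣ N G (D₁ ∪ D₂) ∣ ≤ ∣ N G D₁ ∣ + ∣ N G D₂ ∣
  ∣crossing∣+∣N-∪∣≤∣N∣+∣N∣ D₁ D₂ = p∪q⊆r∪s∧p∩q⊆r∩s⇒∣p∣+∣q∣≤∣r∣+∣s∣ ∪⊆ ∩⊆
    where
    X : Subset n
    X = crossing D₁ D₂
    ∪⊆ : X ∪ N G (D₁ ∪ D₂) ⊆ N G D₁ ∪ N G D₂
    ∪⊆ x∈ with x∈p∪q⁻ X (N G (D₁ ∪ D₂)) x∈
    ... | inj₂ x∈N-∪ = N-∪⊆N∪N D₁ D₂ x∈N-∪
    ... | inj₁ x∈X with ∈crossing⁻ x∈X
    ...   | x∈N[D₁] , _ , inj₁ x∉D₁ = x∈p∪q⁺ (inj₁ (∈N[]∧∉⇒∈N x∈N[D₁] x∉D₁))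
    ...   | _ , x∈N[D₂] , inj₂ x∉D₂ = x∈p∪q⁺ (inj₂ (∈N[]∧∉⇒∈N x∈N[D₂] x∉D₂))
    ∩⊆ : X ∩ N G (D₁ ∪ D₂) ⊆ N G D₁ ∩ N G D₂
    ∩⊆ x∈
      with x∈X , x∈N-∪ ← x∈p∩q⁻ X (N G (D₁ ∪ D₂)) x∈
      with x∈N[D₁] , x∈N[D₂] , _ ← ∈crossing⁻ x∈X
      = x∈p∩q⁺ ( ∈N[]∧∉⇒∈N x∈N[D₁] (x∉p∪q⇒x∉p D₁ D₂ (proj₁ (∈N⁻ x∈N-∪)))
               , ∈N[]∧∉⇒∈N x∈N[D₂] (x∉p∪q⇒x∉q D₁ D₂ (proj₁ (∈N⁻ x∈N-∪))))

  crossing<3⇒disjoint : KConnected G 3 → ∀ {D₁ D₂} → ∣ crossing D₁ D₂ ∣ < 3 →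
    (∃ λ w → w ∉ N[_] G D₁) → ∀ v → v ∈ D₁ → v ∈ D₂ → ⊥
  crossing<3⇒disjoint (_ , connected) {D₁} {D₂} X<3 (w , w∉N[D₁]) v v∈D₁ v∈D₂ =
    w∉N[D₁] (x∈p∪q⁺ (inj₁ (proj₁ (x∈p∩q⁻ D₁ D₂ w∈D₁∩D₂))))
    where
    X : Subset n
    X = crossing D₁ D₂
    v∉X : v ∉ X
    v∉X v∈X with ∈crossing⁻ v∈X
    ... | _ , _ , inj₁ v∉D₁ = v∉D₁ v∈D₁
    ... | _ , _ , inj₂ v∉D₂ = v∉D₂ v∈D₂
    w∉X : w ∉ X
    w∉X w∈X = w∉N[D₁] (proj₁ (∈crossing⁻ w∈X))
    path : Reach G (∁ X) v w
    path = proj₂ (connected X X<3) v w (x∉p⇒x∈∁p v∉X) (x∉p⇒x∈∁p w∉X)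
    closed : ∀ {x y} → x ∈ D₁ ∩ D₂ → Adj G x y → y ∈ ∁ X → y ∈ D₁ ∩ D₂
    closed {x} {y} x∈D₁∩D₂ xy y∈∁X =
      x∈p∩q⁺ ( x∉∁p⇒x∈p (λ y∈∁D₁ → y∉X (∈crossing⁺ y∈N[D₁] y∈N[D₂] (inj₁ (x∈∁p⇒x∉p y∈∁D₁))))
             , x∉∁p⇒x∈p (λ y∈∁D₂ → y∉X (∈crossing⁺ y∈N[D₁] y∈N[D₂] (inj₂ (x∈∁p⇒x∉p y∈∁D₂)))))
      where
      y∉X : y ∉ X
      y∉X = x∈∁p⇒x∉p y∈∁X
      y∈N[D₁] : y ∈ N[_] G D₁
      y∈N[D₁] = ∈N[]⁺ (proj₁ (x∈p∩q⁻ D₁ D₂ x∈D₁∩D₂)) xy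
      y∈N[D₂] : y ∈ N[_] G D₂
      y∈N[D₂] = ∈N[]⁺ (proj₂ (x∈p∩q⁻ D₁ D₂ x∈D₁∩D₂)) xy
    w∈D₁∩D₂ : w ∈ D₁ ∩ D₂
    w∈D₁∩D₂ = Reach-closed closed path (x∈p∩q⁺ (v∈D₁ , v∈D₂))

  cross-edge⇒∈crossing : ∀ {D₁ D₂} → x ∈ D₁ → y ∈ D₂ → Adj G x y → x ∉ D₂ → y ∉ D₁ →
                         x ∈ crossing D₁ D₂ × y ∈ crossing D₁ D₂
  cross-edge⇒∈crossing x∈D₁ y∈D₂ xy x∉D₂ y∉D₁ =
    ∈crossing⁺ (x∈p∪q⁺ (inj₁ x∈D₁)) (∈N[]⁺ y∈D₂ (Adj-sym xy)) (inj₂ x∉D₂) ,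
    ∈crossing⁺ (∈N[]⁺ x∈D₁ xy) (x∈p∪q⁺ (inj₁ y∈D₂)) (inj₁ y∉D₁)

  crossing<3⇒cross-edge-unique : ∀ {D₁ D₂} → ∣ crossing D₁ D₂ ∣ < 3 →
    (∀ v → v ∈ D₁ → v ∈ D₂ → ⊥) →
    ∀ u₁ v₁ u₂ v₂ → u₁ ∈ D₁ → v₁ ∈ D₂ → u₂ ∈ D₁ → v₂ ∈ D₂ →
    Adj G u₁ v₁ → Adj G u₂ v₂ → (u₁ ≡ u₂) × (v₁ ≡ v₂)
  crossing<3⇒cross-edge-unique {D₁} {D₂} X<3 disjoint u₁ v₁ u₂ v₂ u₁∈D₁ v₁∈D₂ u₂∈D₁ v₂∈D₂ u₁v₁ u₂v₂ =
    ends-equal (u₁ ≟ u₂) (v₁ ≟ v₂)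
    where
    ends₁ : u₁ ∈ crossing D₁ D₂ × v₁ ∈ crossing D₁ D₂
    ends₁ = cross-edge⇒∈crossing u₁∈D₁ v₁∈D₂ u₁v₁ (disjoint u₁ u₁∈D₁) (λ v₁∈D₁ → disjoint v₁ v₁∈D₁ v₁∈D₂)
    ends₂ : u₂ ∈ crossing D₁ D₂ × v₂ ∈ crossing D₁ D₂
    ends₂ = cross-edge⇒∈crossing u₂∈D₁ v₂∈D₂ u₂v₂ (disjoint u₂ u₂∈D₁) (λ v₂∈D₁ → disjoint v₂ v₂∈D₁ v₂∈D₂)
    distinct : x ∈ D₁ → y ∈ D₂ → x ≢ y
    distinct {x} x∈D₁ x∈D₂ refl = disjoint x x∈D₁ x∈D₂
    ends-equal : Dec (u₁ ≡ u₂) → Dec (v₁ ≡ v₂) → (u₁ ≡ u₂) × (v₁ ≡ v₂)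
    ends-equal (yes u₁≡u₂) (yes v₁≡v₂) = u₁≡u₂ , v₁≡v₂
    ends-equal (no u₁≢u₂) _ = ⊥-elim (<⇒≱ X<3
      (x,y,z∈p⇒3≤∣p∣ (proj₁ ends₁) (proj₁ ends₂) (proj₂ ends₁) u₁≢u₂ (distinct u₁∈D₁ v₁∈D₂) (distinct u₂∈D₁ v₁∈D₂)))
    ends-equal (yes _) (no v₁≢v₂) = ⊥-elim (<⇒≱ X<3
      (x,y,z∈p⇒3≤∣p∣ (proj₂ ends₁) (proj₂ ends₂) (proj₁ ends₁) v₁≢v₂
        (≢-sym (distinct u₁∈D₁ v₁∈D₂)) (≢-sym (distinct u₁∈D₁ v₂∈D₂))))

module _ (G : Graph n) {k : ℕ} {𝒯 : Subset n → Subset n → Set} (tangle : IsTangle G k 𝒯) where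

  private
    orient : ∀ A B → IsSeparation G A B → order G A B < k → 𝒯 A B ⊎ 𝒯 B A
    orient = proj₁ (proj₂ tangle)
    no-cover : ∀ A₁ B₁ A₂ B₂ A₃ B₃ → 𝒯 A₁ B₁ → 𝒯 A₂ B₂ → 𝒯 A₃ B₃ → A₁ ∪ (A₂ ∪ A₃) ≢ ⊤
    no-cover = proj₂ (proj₂ tangle)

  𝒯-small-side-misses : ∀ {A B} → 𝒯 A B → ∃ λ x → x ∉ A
  𝒯-small-side-misses {A} {B} AB∈𝒯 with nonempty? (∁ A)
  ... | yes (x , x∈∁A) = x , x∈∁p⇒x∉p x∈∁A
  ... | no ∁A-empty = ⊥-elim (no-cover A B A B A B AB∈𝒯 AB∈𝒯 AB∈𝒯 (all∈⇒≡⊤ λ x →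
          x∈p∪q⁺ (inj₁ (x∉∁p⇒x∈p λ x∈∁A → ∁A-empty (x , x∈∁A)))))

  covered⇒𝒯 : ∀ {A₁ B₁ A₂ B₂ A B} → 𝒯 A₁ B₁ → 𝒯 A₂ B₂ →
              IsSeparation G A B → order G A B < k → (∀ x → x ∈ A₁ ∪ (A₂ ∪ B)) → 𝒯 A B
  covered⇒𝒯 t₁ t₂ sep ord cover with orient _ _ sep ord
  ... | inj₁ AB∈𝒯 = AB∈𝒯
  ... | inj₂ BA∈𝒯 = ⊥-elim (no-cover _ _ _ _ _ _ t₁ t₂ BA∈𝒯 (all∈⇒≡⊤ cover))

  ∪-isPredongle : 4 ≤ k → ∀ {D₁ D₂} → IsPredongle G 𝒯 D₁ → IsPredongle G 𝒯 D₂ →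
                  ∣ N G (D₁ ∪ D₂) ∣ ≤ 3 → IsPredongle G 𝒯 (D₁ ∪ D₂)
  ∪-isPredongle 4≤k {D₁} {D₂} (_ , t₁) (_ , t₂) ∣N∣≤3 =
    ∣N∣≤3 , covered⇒𝒯 t₁ t₂ (N[]-∁-separation G D) order<k cover
    where
    D : Subset n
    D = D₁ ∪ D₂
    order<k : order G (N[_] G D) (∁ D) < k
    order<k = ≤-trans (s≤s (≤-trans (order-N[]-∁≤∣N∣ G D) ∣N∣≤3)) 4≤k
    cover : ∀ x → x ∈ N[_] G D₁ ∪ (N[_] G D₂ ∪ ∁ D)
    cover x with x ∈? D
    ... | no x∉D = x∈p∪q⁺ (inj₂ (x∈p∪q⁺ (inj₂ (x∉p⇒x∈∁p x∉D))))
    ... | yes x∈D with x∈p∪q⁻ D₁ D₂ x∈D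
    ...   | inj₁ x∈D₁ = x∈p∪q⁺ (inj₁ (x∈p∪q⁺ (inj₁ x∈D₁)))
    ...   | inj₂ x∈D₂ = x∈p∪q⁺ (inj₂ (x∈p∪q⁺ (inj₁ (x∈p∪q⁺ (inj₁ x∈D₂)))))

  maximal-predongles⇒∣crossing∣<3 : 4 ≤ k → ∀ {D₁ D₂} →
    IsMaximalPredongle G 𝒯 D₁ → IsMaximalPredongle G 𝒯 D₂ → D₁ ≢ D₂ → ∣ crossing G D₁ D₂ ∣ < 3
  maximal-predongles⇒∣crossing∣<3 4≤k {D₁} {D₂} (pre₁ , max₁) (pre₂ , max₂) D₁≢D₂
    with ∣ crossing G D₁ D₂ ∣ <? 3
  ... | yes X<3 = X<3
  ... | no X≮3 = ⊥-elim (D₁≢D₂ (trans (≡-sym (max₁ D pre (p⊆p∪q D₂))) (max₂ D pre (q⊆p∪q D₁ D₂))))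
    where
    D : Subset n
    D = D₁ ∪ D₂
    ∣N∣≤3 : ∣ N G D ∣ ≤ 3
    ∣N∣≤3 = +-cancelˡ-≤ 3 _ _ (begin
      3 + ∣ N G D ∣                    ≤⟨ +-mono-≤ (≮⇒≥ X≮3) ≤-refl ⟩
      ∣ crossing G D₁ D₂ ∣ + ∣ N G D ∣ ≤⟨ ∣crossing∣+∣N-∪∣≤∣N∣+∣N∣ G D₁ D₂ ⟩
      ∣ N G D₁ ∣ + ∣ N G D₂ ∣          ≤⟨ +-mono-≤ (proj₁ pre₁) (proj₁ pre₂) ⟩
      3 + 3                            ∎)
      where open ≤-Reasoning
    pre : IsPredongle G 𝒯 D
    pre = ∪-isPredongle 4≤k pre₁ pre₂ ∣N∣≤3

lemma6p7 : ∀ {n : ℕ} (G : Graph n) → KConnected G 3 →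
    ∀ (k : ℕ) (𝒯 : Subset n → Subset n → Set) → 4 ≤ k → IsTangle G k 𝒯 →
    ∀ (D₁ D₂ : Subset n) →
    IsMaximalPredongle G 𝒯 D₁ → IsMaximalPredongle G 𝒯 D₂ → D₁ ≢ D₂ →
    (∀ v → v ∈ D₁ → v ∈ D₂ → ⊥) ×
    (∀ u₁ v₁ u₂ v₂ → u₁ ∈ D₁ → v₁ ∈ D₂ → u₂ ∈ D₁ → v₂ ∈ D₂ →
       Adj G u₁ v₁ → Adj G u₂ v₂ → (u₁ ≡ u₂) × (v₁ ≡ v₂))
lemma6p7 G 3-connected k 𝒯 4≤k tangle D₁ D₂ maximal₁ maximal₂ D₁≢D₂ =
  disjoint , crossing<3⇒cross-edge-unique G ∣X∣<3 disjoint
  where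
  ∣X∣<3 : ∣ crossing G D₁ D₂ ∣ < 3
  ∣X∣<3 = maximal-predongles⇒∣crossing∣<3 G tangle 4≤k maximal₁ maximal₂ D₁≢D₂
  disjoint : ∀ v → v ∈ D₁ → v ∈ D₂ → ⊥
  disjoint = crossing<3⇒disjoint G 3-connected ∣X∣<3
               (𝒯-small-side-misses G tangle (proj₂ (proj₁ maximal₁)))
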